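{- Let $j\ge1$ and $k\ge 1$ be integers. (a) For every squarefree integer $n\ge1$, $$E^{*}_{j,k}(n)\le k\Bigl(\frac{j+2}{2^{\frac{2}{j+2}}}\Bigr)^{\omega(n)}.$$ (b) For every integer $n\ge1$, $$E_{j,k}(n)\le k\prod_{p^v\| n}\bigl((j+1)v^{\frac{j}{j+1}}\bigr).$$
   Context: For an integer $n\ge1$, $\mathcal{D}_n$ denotes the set of positive divisors of $n$, and $\omega(n)$ the number of distinct prime factors of $n$. A set $U\subseteq\mathcal{D}_n^j$ is called regular if every tuple in $U$ has pairwise coprime entries. For an integer $k\ge1$, a map $g:U_g\to\mathcal{D}_n$ defined on a regular set $U_g\subseteq \mathcal{D}_n^j$ is called $k$-regular if (0) for every $(d_1,\dots,d_j)\in U_g$ one has $\gcd(g(d_1,\dots,d_j),d_i)=1$ for each $i$; (1) for each $1\le i\le j$ and each fixed choice of the other coordinates $d_1,\dots,d_{i-1},d_{i+1},\dots,d_j$ and of $d$, the equation $g(d_1,\dots,d_{i-1},z,d_{i+1},\dots,d_j)=d$ has at most $k$ solutions $z$ with the tuple in $U_g$; (2) under the same fixing, the equation $z\,g(d_1,\dots,d_{i-1},z,d_{i+1},\dots,d_j)=d$ has at most $k$ solutions $z$ with the tuple in $U_g$. The map is strongly $k$-regular if moreover (3) for each $1\le i_1<i_2\le j$ and each fixed choice of all other coordinates and of $d,d'$, the system $g(\dots,z_1,\dots,z_2,\dots)=d$, $z_1z_2=d'$ (with $z_1,z_2$ in positions $i_1,i_2$) has at most $k$ solutions $(z_1,z_2)$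 with the tuple in $U_g$. $E_{j,k}(n)$ (resp. $E^*_{j,k}(n)$) is the maximum of $|U_g|$ over all $k$-regular (resp. strongly $k$-regular) maps $g$. -}

module Defs where

open import Data.Nat using (ℕ; zero; suc; _+_; _*_; _^_; _≤_; _<_)
open import Data.Nat.Divisibility using (_∣_; _∣?_)
open import Data.Nat.Coprimality using (Coprime)
open import Data.Nat.Primality using (Prime; prime?)
open import Data.Fin using (Fin)
import Data.Fin
import Data.Product
open import Data.Vec using (Vec; lookup; _[_]≔_)
open import Data.List using (List; length; filter; upTo; map)
open import Data.List.Membership.Propositional using (_∈_)
open import Data.List.Relation.Unary.All using (All)
open import Data.List.Relation.Unary.Unique.Propositional using (Unique)
open import Data.Product using (_×_; _,_)
open import Relation.Binary.PropositionalEquality using (_≡_; _≢_)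
open import Relation.Nullary using (¬_)

Tuple : ℕ → Set
Tuple j = Vec ℕ j

InDivisors : ℕ → {j : ℕ} → Tuple j → Set
InDivisors n {j} u = (i : Fin j) → lookup u i ∣ n

PairwiseCoprime : {j : ℕ} → Tuple j → Set
PairwiseCoprime {j} u = (a b : Fin j) → a ≢ b → Coprime (lookup u a) (lookup u b)

record RegularSet (n j : ℕ) : Set where
  field
    elems    : List (Tuple j)
    unique   : Unique elems
    divisors : All (InDivisors n) elems
    regular  : All PairwiseCoprime elems
open RegularSet public

-- "the predicate P has at most k solutions z" : every duplicate-free list of solutions has length ≤ k
AtMost : {A : Set} → ℕ → (A → Set) → Set
AtMost {A} k P = (zs : List A) → Unique zs → All P zs → length zs ≤ k

-- k-regular map g : U → D_n (g given as a function on all tuples; only its values on U matter)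
record KRegular (n j k : ℕ) (U : RegularSet n j) (g : Tuple j → ℕ) : Set where
  field
    codomain : (u : Tuple j) → u ∈ elems U → g u ∣ n
    cond0 : (u : Tuple j) → u ∈ elems U → (i : Fin j) → Coprime (g u) (lookup u i)
    cond1 : (t : Tuple j) (i : Fin j) (d : ℕ) →
            AtMost k (λ z → ((t [ i ]≔ z) ∈ elems U) × (g (t [ i ]≔ z) ≡ d))
    cond2 : (t : Tuple j) (i : Fin j) (d : ℕ) →
            AtMost k (λ z → ((t [ i ]≔ z) ∈ elems U) × (z * g (t [ i ]≔ z) ≡ d))

record StronglyKRegular (n j k : ℕ) (U : RegularSet n j) (g : Tuple j → ℕ) : Set where
  field
    kregular : KRegular n j k U g
    cond3 : (t : Tuple j) (i₁ i₂ : Fin j) → Data.Fin._<_ i₁ i₂ → (d d' : ℕ) →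
            AtMost k (λ (zz : ℕ × ℕ) → let z₁ = Data.Product.proj₁ zz ; z₂ = Data.Product.proj₂ zz
                                           u = (t [ i₁ ]≔ z₁) [ i₂ ]≔ z₂ in
                                       (u ∈ elems U) × (g u ≡ d) × (z₁ * z₂ ≡ d'))

-- primes dividing n (for n ≥ 1 all such primes are ≤ n)
primeDivisors : ℕ → List ℕ
primeDivisors n = filter prime? (filter (_∣? n) (upTo (suc n)))

ω : ℕ → ℕ
ω n = length (primeDivisors n)

-- v_p(n) for p ≥ 2, n ≥ 1: number of v ∈ {1,…,n} with p^v ∣ n  (equals the exponent v with p^v ∥ n)
val : ℕ → ℕ → ℕ
val p n = length (filter (λ v → (p ^ v) ∣? n) (map suc (upTo n)))

Squarefree : ℕ → Set
Squarefree n = (p : ℕ) → Prime p → ¬ (p * p ∣ n)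

-- Both bounds come from one double-counting inequality. Let every element x of a finite set W and
-- every direction d among N directions determine a set of compatible labels from a list Y, so that
-- each label is compatible in direction d with at most k elements, and the product over d of the
-- numbers of labels compatible with x is at least V. Summing these numbers over x and d gives at
-- most N |Y| k, while by AM-GM the inner sum for each x is at least N V^(1/N); hence
-- |W|^N V ≤ k^N |Y|^N.
--
-- For (b), W consists of the tuples u ∈ U, extended to (g u, u₁, …, u_j), the directions are the
-- j + 1 entries, and a label chooses, for every prime p ∣ n, an entry and an exponent in
-- 1 … v_p(n); it is compatible with u in direction l if it gives the p-adic valuations of all
-- entries other than the l-th. Two tuples sharing a label agree outside entry l, which
-- k-regularity controls, and pairwise coprimality makes every prime contribute a factor v_p(n) to V.
--
-- For (a), n is squarefree, so a tuple is determined by the symbol of each prime p ∣ n: the entry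
-- it divides, or none, one of j + 2 symbols. The directions are the ordered pairs a ≠ b of symbols,
-- and a label is a symbol per prime that equals the symbol of p after identifying b with a. Two
-- tuples sharing a label agree outside the entries a, b and on the product of these two entries,
-- which strong k-regularity controls; every prime contributes 2^(2(j+1)) to V, and a
-- (j+1)-th root gives the bound.

module Submission where

open import Defs
open import Data.Nat using (ℕ; _+_; _*_; _^_; _≤_)
open import Data.Vec using (Vec)
open import Data.List using (length; map)
open import Data.Nat.ListAction using (product)
open import Data.Product using (_×_)

open import Data.Bool using (Bool; true; false; T; if_then_else_; _∧_)
open import Data.Bool.Properties using (T?; T-∧)
open import Data.Empty using (⊥-elim)
open import Data.Fin using (Fin; zero; suc; punchIn; punchOut)
import Data.Fin as Fin
import Data.Fin.Properties as Finₚ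
open import Data.List using (List; []; _∷_; _++_; _∷ʳ_; filter; upTo; allFin; cartesianProductWith; cartesianProduct)
open import Data.List.Extrema.Nat using (argmin; argmin-all; f[argmin]≤f[⊤]; f[argmin]≤f[xs])
open import Data.List.Membership.Propositional using (_∈_)
open import Data.List.Membership.Propositional.Properties
  using (∈-filter⁺; ∈-filter⁻; ∈-upTo⁺; ∈-upTo⁻; ∈-map⁻; ∈-allFin; ∈-cartesianProduct⁺)
open import Data.List.Properties using (length-++; length-map; length-upTo; length-tabulate; map-++; map-∘; map-tabulate; upTo-∷ʳ)
import Data.List.Properties as Listₚ
open import Data.List.Relation.Unary.All as All using (All; []; _∷_)
open import Data.List.Relation.Unary.Any using (here; there)
open import Data.List.Relation.Unary.Unique.Propositional using (Unique; []; _∷_)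
import Data.List.Relation.Unary.Unique.Propositional.Properties as Uniqueₚ
open import Data.Nat using (zero; suc; _<_; _∸_; z≤n; s≤s; NonZero; >-nonZero; _≟_)
open import Data.Nat.Coprimality using (Coprime; coprime-divisor)
import Data.Nat.Coprimality as Coprime
open import Data.Nat.Divisibility
open import Data.Nat.ListAction using (sum)
open import Data.Nat.ListAction.Properties using (sum-++; product-++)
open import Data.Nat.Primality
open import Data.Nat.Primality.Factorisation using (PrimeFactorisation; factorise)
open import Data.Nat.Properties hiding (suc-injective)
open import Algebra.Properties.CommutativeSemigroup +-commutativeSemigroup
  using () renaming (interchange to +-interchange)
open import Algebra.Properties.CommutativeSemigroup *-commutativeSemigroup
  using (x∙yz≈y∙xz) renaming (interchange to *-interchange)
open import Data.Nat.Tactic.RingSolver using (solve-∀)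
open import Data.Product using (∃; _,_; proj₁; proj₂)
import Data.Product as Product
open import Data.Sum using (_⊎_; inj₁; inj₂; [_,_]′)
import Data.Sum as Sum
open import Data.Vec using (_∷_; lookup; _[_]≔_)
import Data.Vec.Properties as Vecₚ
open import Function using (_∘_; _⇔_; mk⇔; Equivalence)
import Function.Properties.Equivalence as ⇔
open import Relation.Binary.Definitions using (tri<; tri≈; tri>)
open import Relation.Binary.PropositionalEquality
open import Relation.Nullary using (¬_; Dec; yes; no)
open import Relation.Nullary.Decidable using (isYes; toWitness; fromWitness; ¬?; _→-dec_; _×-dec_)
open import Relation.Unary using (Decidable)

private
  variable
    A B C I : Set
    a b d m n p q v : ℕ

-- Sums, products and counts over lists

∑ : List A → (A → ℕ) → ℕ
∑ xs f = sum (map f xs)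

∏ : List A → (A → ℕ) → ℕ
∏ xs f = product (map f xs)

syntax ∑ xs (λ x → e) = ∑[ x ∈ xs ] e
syntax ∏ xs (λ x → e) = ∏[ x ∈ xs ] e

module _ {f g : A → ℕ} where

  ∑-cong : ∀ xs → (∀ {x} → x ∈ xs → f x ≡ g x) → ∑ xs f ≡ ∑ xs g
  ∑-cong []       _  = refl
  ∑-cong (x ∷ xs) eq = cong₂ _+_ (eq (here refl)) (∑-cong xs (λ m → eq (there m)))

  ∑-mono-≤ : ∀ xs → (∀ {x} → x ∈ xs → f x ≤ g x) → ∑ xs f ≤ ∑ xs g
  ∑-mono-≤ []       _  = z≤n
  ∑-mono-≤ (x ∷ xs) le = +-mono-≤ (le (here refl)) (∑-mono-≤ xs (λ m → le (there m)))

  ∏-cong : ∀ xs → (∀ {x} → x ∈ xs → f x ≡ g x) → ∏ xs f ≡ ∏ xs g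
  ∏-cong []       _  = refl
  ∏-cong (x ∷ xs) eq = cong₂ _*_ (eq (here refl)) (∏-cong xs (λ m → eq (there m)))

  ∏-mono-≤ : ∀ xs → (∀ {x} → x ∈ xs → f x ≤ g x) → ∏ xs f ≤ ∏ xs g
  ∏-mono-≤ []       _  = ≤-refl
  ∏-mono-≤ (x ∷ xs) le = *-mono-≤ (le (here refl)) (∏-mono-≤ xs (λ m → le (there m)))

  ∑-+ : ∀ xs → ∑[ x ∈ xs ] (f x + g x) ≡ ∑ xs f + ∑ xs g
  ∑-+ []       = refl
  ∑-+ (x ∷ xs) = trans (cong (f x + g x +_) (∑-+ xs)) (+-interchange (f x) (g x) (∑ xs f) (∑ xs g))

  ∏-* : ∀ xs → ∏[ x ∈ xs ] (f x * g x) ≡ ∏ xs f * ∏ xs g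
  ∏-* []       = refl
  ∏-* (x ∷ xs) = trans (cong (f x * g x *_) (∏-* xs)) (*-interchange (f x) (g x) (∏ xs f) (∏ xs g))

∑-const : ∀ (xs : List A) c → ∑[ x ∈ xs ] c ≡ length xs * c
∑-const []       c = refl
∑-const (x ∷ xs) c = cong (c +_) (∑-const xs c)

∏-const : ∀ (xs : List A) c → ∏[ x ∈ xs ] c ≡ c ^ length xs
∏-const []       c = refl
∏-const (x ∷ xs) c = cong (c *_) (∏-const xs c)

∑-≤-const : ∀ {f : A → ℕ} {c} xs → (∀ {x} → x ∈ xs → f x ≤ c) → ∑ xs f ≤ length xs * c
∑-≤-const {c = c} xs le = ≤-trans (∑-mono-≤ xs le) (≤-reflexive (∑-const xs c))

∑-≥-const : ∀ {f : A → ℕ} {c} xs → (∀ {x} → x ∈ xs → c ≤ f x) → length xs * c ≤ ∑ xs f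
∑-≥-const {c = c} xs le = ≤-trans (≤-reflexive (sym (∑-const xs c))) (∑-mono-≤ xs le)

∑-*ˡ : ∀ c (f : A → ℕ) xs → ∑[ x ∈ xs ] (c * f x) ≡ c * ∑ xs f
∑-*ˡ c f []       = sym (*-zeroʳ c)
∑-*ˡ c f (x ∷ xs) = trans (cong (c * f x +_) (∑-*ˡ c f xs)) (sym (*-distribˡ-+ c (f x) (∑ xs f)))

∑-*ʳ : ∀ c (f : A → ℕ) xs → ∑[ x ∈ xs ] (f x * c) ≡ ∑ xs f * c
∑-*ʳ c f []       = refl
∑-*ʳ c f (x ∷ xs) = trans (cong (f x * c +_) (∑-*ʳ c f xs)) (sym (*-distribʳ-+ c (f x) (∑ xs f)))

^-distribʳ-* : ∀ m n o → (m * n) ^ o ≡ m ^ o * n ^ o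
^-distribʳ-* m n zero    = refl
^-distribʳ-* m n (suc o) = trans (cong (m * n *_) (^-distribʳ-* m n o)) (*-interchange m n (m ^ o) (n ^ o))

∏-^ : ∀ (f : A → ℕ) e xs → ∏[ x ∈ xs ] (f x ^ e) ≡ ∏ xs f ^ e
∏-^ f e []       = sym (^-zeroˡ e)
∏-^ f e (x ∷ xs) = trans (cong (f x ^ e *_) (∏-^ f e xs)) (sym (^-distribʳ-* (f x) (∏ xs f) e))

∑-swap : ∀ (f : A → B → ℕ) xs ys → ∑[ x ∈ xs ] ∑[ y ∈ ys ] f x y ≡ ∑[ y ∈ ys ] ∑[ x ∈ xs ] f x y
∑-swap f []       ys = sym (trans (∑-const ys 0) (*-zeroʳ (length ys)))
∑-swap f (x ∷ xs) ys = trans (cong (∑ ys (f x) +_) (∑-swap f xs ys)) (sym (∑-+ ys))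

∏-swap : ∀ (f : A → B → ℕ) xs ys → ∏[ x ∈ xs ] ∏[ y ∈ ys ] f x y ≡ ∏[ y ∈ ys ] ∏[ x ∈ xs ] f x y
∏-swap f []       ys = sym (trans (∏-const ys 1) (^-zeroˡ (length ys)))
∏-swap f (x ∷ xs) ys = trans (cong (∏ ys (f x) *_) (∏-swap f xs ys)) (sym (∏-* ys))

∑-cartesianProductWith : ∀ (h : C → ℕ) (f : A → B → C) xs ys →
  ∑ (cartesianProductWith f xs ys) h ≡ ∑[ x ∈ xs ] ∑[ y ∈ ys ] h (f x y)
∑-cartesianProductWith h f []       ys = refl
∑-cartesianProductWith h f (x ∷ xs) ys = begin
  sum (map h (map (f x) ys ++ cartesianProductWith f xs ys))
    ≡⟨ cong sum (map-++ h (map (f x) ys) _) ⟩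
  sum (map h (map (f x) ys) ++ map h (cartesianProductWith f xs ys))
    ≡⟨ sum-++ (map h (map (f x) ys)) _ ⟩
  ∑ (map (f x) ys) h + ∑ (cartesianProductWith f xs ys) h
    ≡⟨ cong₂ _+_ (cong sum (sym (map-∘ ys))) (∑-cartesianProductWith h f xs ys) ⟩
  ∑[ y ∈ ys ] h (f x y) + ∑[ x ∈ xs ] ∑[ y ∈ ys ] h (f x y)
    ∎
  where
  open ≡-Reasoning

∏-cartesianProductWith : ∀ (h : C → ℕ) (f : A → B → C) xs ys →
  ∏ (cartesianProductWith f xs ys) h ≡ ∏[ x ∈ xs ] ∏[ y ∈ ys ] h (f x y)
∏-cartesianProductWith h f []       ys = refl
∏-cartesianProductWith h f (x ∷ xs) ys = begin
  product (map h (map (f x) ys ++ cartesianProductWith f xs ys))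
    ≡⟨ cong product (map-++ h (map (f x) ys) _) ⟩
  product (map h (map (f x) ys) ++ map h (cartesianProductWith f xs ys))
    ≡⟨ product-++ (map h (map (f x) ys)) _ ⟩
  ∏ (map (f x) ys) h * ∏ (cartesianProductWith f xs ys) h
    ≡⟨ cong₂ _*_ (cong product (sym (map-∘ ys))) (∏-cartesianProductWith h f xs ys) ⟩
  ∏[ y ∈ ys ] h (f x y) * ∏[ x ∈ xs ] ∏[ y ∈ ys ] h (f x y)
    ∎
  where
  open ≡-Reasoning

length-cartesianProductWith : ∀ (f : A → B → C) xs ys →
  length (cartesianProductWith f xs ys) ≡ length xs * length ys
length-cartesianProductWith f []       ys = refl
length-cartesianProductWith f (x ∷ xs) ys = begin
  length (map (f x) ys ++ cartesianProductWith f xs ys)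
    ≡⟨ length-++ (map (f x) ys) ⟩
  length (map (f x) ys) + length (cartesianProductWith f xs ys)
    ≡⟨ cong₂ _+_ (length-map (f x) ys) (length-cartesianProductWith f xs ys) ⟩
  length ys + length xs * length ys
    ∎
  where open ≡-Reasoning

∑-≥-member : ∀ (f : A → ℕ) {xs x} → x ∈ xs → f x ≤ ∑ xs f
∑-≥-member f {x ∷ xs} (here refl) = m≤m+n (f x) (∑ xs f)
∑-≥-member f {y ∷ xs} (there m)   = ≤-trans (∑-≥-member f m) (m≤n+m _ (f y))

module _ {f : A → ℕ} where

  ∏-pos : ∀ xs → (∀ {x} → x ∈ xs → 1 ≤ f x) → 1 ≤ ∏ xs f
  ∏-pos []       _   = ≤-refl
  ∏-pos (x ∷ xs) pos = *-mono-≤ (pos (here refl)) (∏-pos xs (λ m → pos (there m)))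

  ∏-≥-member : ∀ {xs x} → (∀ {x} → x ∈ xs → 1 ≤ f x) → x ∈ xs → f x ≤ ∏ xs f
  ∏-≥-member {x ∷ xs} pos (here refl) =
    ≤-trans (≤-reflexive (sym (*-identityʳ (f x)))) (*-monoʳ-≤ (f x) (∏-pos xs (λ m → pos (there m))))
  ∏-≥-member {y ∷ xs} {x} pos (there m) =
    ≤-trans (≤-reflexive (sym (*-identityˡ (f x)))) (*-mono-≤ (pos (here refl)) (∏-≥-member (λ m → pos (there m)) m))

length-allFin : ∀ m → length (allFin m) ≡ m
length-allFin m = length-tabulate (λ a → a)

∏-allFin-suc : ∀ m (h : Fin (suc m) → ℕ) → ∏[ a ∈ allFin (suc m) ] h a ≡ h zero * ∏[ a ∈ allFin m ] h (suc a)
∏-allFin-suc m h = cong (λ l → h zero * product l) (trans (map-tabulate suc h) (sym (map-tabulate (λ a → a) (h ∘ suc))))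

∏-allFin-≥ : ∀ m (h : Fin (suc m) → ℕ) σ {c} → (∀ a → a ≢ σ → c ≤ h a) → h σ * c ^ m ≤ ∏[ a ∈ allFin (suc m) ] h a
∏-allFin-≥ m h zero {c} h≥c = begin
  h zero * c ^ m                          ≡⟨ cong (h zero *_) (sym (trans (∏-const (allFin m) c) (cong (c ^_) (length-allFin m)))) ⟩
  h zero * ∏[ a ∈ allFin m ] c            ≤⟨ *-monoʳ-≤ (h zero) (∏-mono-≤ (allFin m) (λ {a} _ → h≥c (suc a) (λ ()))) ⟩
  h zero * ∏[ a ∈ allFin m ] h (suc a)    ≡⟨ sym (∏-allFin-suc m h) ⟩
  ∏[ a ∈ allFin (suc m) ] h a             ∎
  where open ≤-Reasoning
∏-allFin-≥ (suc m) h (suc σ) {c} h≥c = begin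
  h (suc σ) * (c * c ^ m)                     ≡⟨ x∙yz≈y∙xz (h (suc σ)) c (c ^ m) ⟩
  c * (h (suc σ) * c ^ m)                     ≤⟨ *-mono-≤ (h≥c zero (λ ())) (∏-allFin-≥ m (h ∘ suc) σ h∘suc≥c) ⟩
  h zero * ∏[ a ∈ allFin (suc m) ] h (suc a)  ≡⟨ sym (∏-allFin-suc (suc m) h) ⟩
  ∏[ a ∈ allFin (suc (suc m)) ] h a           ∎
  where
  open ≤-Reasoning
  h∘suc≥c : ∀ a → a ≢ σ → c ≤ h (suc a)
  h∘suc≥c a a≢σ = h≥c (suc a) (a≢σ ∘ Finₚ.suc-injective)

count : (A → Bool) → List A → ℕ
count p xs = ∑[ x ∈ xs ] (if p x then 1 else 0)

module _ {p : A → Bool} where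

  count-all : ∀ xs → (∀ {x} → x ∈ xs → T (p x)) → count p xs ≡ length xs
  count-all []       _   = refl
  count-all (x ∷ xs) all with p x | all (here refl)
  ... | true | _ = cong suc (count-all xs (λ m → all (there m)))

  count-≥1 : ∀ {xs x} → x ∈ xs → T (p x) → 1 ≤ count p xs
  count-≥1 {x ∷ xs} (here refl) px with p x | px
  ... | true | _ = s≤s z≤n
  count-≥1 {y ∷ xs} (there m)   px = ≤-trans (count-≥1 m px) (m≤n+m _ _)

  count-≥2 : ∀ {xs x y} → x ≢ y → x ∈ xs → y ∈ xs → T (p x) → T (p y) → 2 ≤ count p xs
  count-≥2 x≢y (here refl) (here refl) _ _ = ⊥-elim (x≢y refl)
  count-≥2 {x ∷ _} _ (here refl) (there m) px py with p x | px
  ... | true | _ = s≤s (count-≥1 m py)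
  count-≥2 {y ∷ _} _ (there m) (here refl) px py with p y | py
  ... | true | _ = s≤s (count-≥1 m px)
  count-≥2 {z ∷ _} x≢y (there m) (there m′) px py = ≤-trans (count-≥2 x≢y m m′ px py) (m≤n+m _ _)

  length-filter≡count : ∀ xs → length (filter (λ x → T? (p x)) xs) ≡ count p xs
  length-filter≡count []       = refl
  length-filter≡count (x ∷ xs) with p x
  ... | true  = cong suc (length-filter≡count xs)
  ... | false = length-filter≡count xs

  count≤-AtMost : ∀ {k xs} → Unique xs → AtMost k (λ x → x ∈ xs × T (p x)) → count p xs ≤ k
  count≤-AtMost {k} {xs} uniq atMost = subst (_≤ k) (length-filter≡count xs)
    (atMost (filter (λ x → T? (p x)) xs) (Uniqueₚ.filter⁺ (λ x → T? (p x)) uniq)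
            (All.tabulate (∈-filter⁻ (λ x → T? (p x)))))

count-cartesianProductWith : ∀ {p : C → Bool} {q : A → Bool} {r : B → Bool} (f : A → B → C) →
  (∀ x y → p (f x y) ≡ q x ∧ r y) → ∀ xs ys →
  count p (cartesianProductWith f xs ys) ≡ count q xs * count r ys
count-cartesianProductWith {p = p} {q} {r} f p≡q∧r xs ys = begin
  count p (cartesianProductWith f xs ys)
    ≡⟨ ∑-cartesianProductWith _ f xs ys ⟩
  ∑[ x ∈ xs ] ∑[ y ∈ ys ] (if p (f x y) then 1 else 0)
    ≡⟨ ∑-cong xs (λ {x} _ → ∑-cong ys (λ {y} _ → trans (cong (λ b → if b then 1 else 0) (p≡q∧r x y)) (ind-∧ (q x) (r y)))) ⟩
  ∑[ x ∈ xs ] ∑[ y ∈ ys ] ((if q x then 1 else 0) * (if r y then 1 else 0))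
    ≡⟨ ∑-cong xs (λ {x} _ → ∑-*ˡ (if q x then 1 else 0) (λ y → if r y then 1 else 0) ys) ⟩
  ∑[ x ∈ xs ] ((if q x then 1 else 0) * count r ys)
    ≡⟨ ∑-*ʳ (count r ys) (λ x → if q x then 1 else 0) xs ⟩
  count q xs * count r ys
    ∎
  where
  open ≡-Reasoning
  ind-∧ : ∀ a b → (if a ∧ b then 1 else 0) ≡ (if a then 1 else 0) * (if b then 1 else 0)
  ind-∧ true  b = sym (+-identityʳ _)
  ind-∧ false b = refl

-- Powers and the AM-GM inequality

^-cancelˡ-≤ : ∀ n .{{_ : NonZero n}} {m o} → m ^ n ≤ o ^ n → m ≤ o
^-cancelˡ-≤ n {m} {o} le with m ≤? o
... | yes m≤o = m≤o
... | no  m≰o = ⊥-elim (<⇒≱ (^-monoˡ-< n (≰⇒> m≰o)) le)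

n^n-nonZero : ∀ n → NonZero (n ^ n)
n^n-nonZero zero      = _
n^n-nonZero n@(suc _) = m^n≢0 n n

-- The two halves of the tangent-line inequality B^(m+1) ≥ A^(m+1) + (m+1) A^m (B − A),
-- split by the sign of B − A so that no subtraction occurs.
bernoulli : ∀ A d m → A ^ suc m + suc m * A ^ m * d ≤ (A + d) ^ suc m
bernoulli A d zero    = ≤-reflexive (rearrange A d)
  where
  rearrange : ∀ A d → A * 1 + 1 * 1 * d ≡ (A + d) * 1
  rearrange = solve-∀
bernoulli A d (suc m) = begin
  A * (A * A ^ m) + suc (suc m) * (A * A ^ m) * d
    ≤⟨ m≤m+n _ (suc m * A ^ m * d * d) ⟩
  A * (A * A ^ m) + suc (suc m) * (A * A ^ m) * d + suc m * A ^ m * d * d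
    ≡⟨ rearrange A d m (A ^ m) ⟩
  (A + d) * (A * A ^ m + suc m * A ^ m * d)
    ≤⟨ *-monoʳ-≤ (A + d) (bernoulli A d m) ⟩
  (A + d) * (A + d) ^ suc m
    ∎
  where
  open ≤-Reasoning
  rearrange : ∀ A d m X → A * (A * X) + suc (suc m) * (A * X) * d + suc m * X * d * d
                    ≡ (A + d) * (A * X + suc m * X * d)
  rearrange = solve-∀

bernoulli′ : ∀ A B d m → B + d ≡ A → A ^ suc m ≤ B ^ suc m + suc m * A ^ m * d
bernoulli′ A B d zero    refl = ≤-reflexive (rearrange B d)
  where
  rearrange : ∀ B d → (B + d) * 1 ≡ B * 1 + 1 * 1 * d
  rearrange = solve-∀
bernoulli′ A B d (suc m) B+d≡A = begin
  A * A ^ suc m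
    ≤⟨ *-monoʳ-≤ A (bernoulli′ A B d m B+d≡A) ⟩
  A * (B ^ suc m + suc m * A ^ m * d)
    ≡⟨ cong (λ z → z * (B ^ suc m + suc m * A ^ m * d)) (sym B+d≡A) ⟩
  (B + d) * (B ^ suc m + suc m * A ^ m * d)
    ≡⟨ rearrange₁ B d m (B ^ suc m) (A ^ m) ⟩
  B * B ^ suc m + d * B ^ suc m + (B + d) * (suc m * A ^ m * d)
    ≤⟨ +-monoˡ-≤ _ (+-monoʳ-≤ (B * B ^ suc m) (*-monoʳ-≤ d (^-monoˡ-≤ (suc m) B≤A))) ⟩
  B * B ^ suc m + d * A ^ suc m + (B + d) * (suc m * A ^ m * d)
    ≡⟨ cong (λ z → B * B ^ suc m + d * A ^ suc m + z * (suc m * A ^ m * d)) B+d≡A ⟩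
  B * B ^ suc m + d * A ^ suc m + A * (suc m * A ^ m * d)
    ≡⟨ rearrange₂ (B * B ^ suc m) d A m (A ^ m) ⟩
  B * B ^ suc m + suc (suc m) * (A * A ^ m) * d
    ∎
  where
  open ≤-Reasoning
  B≤A : B ≤ A
  B≤A = subst (B ≤_) B+d≡A (m≤m+n B d)
  rearrange₁ : ∀ B d m Y X → (B + d) * (Y + suc m * X * d) ≡ B * Y + d * Y + (B + d) * (suc m * X * d)
  rearrange₁ = solve-∀
  rearrange₂ : ∀ Z d A m X → Z + d * (A * X) + A * (suc m * X * d) ≡ Z + suc (suc m) * (A * X) * d
  rearrange₂ = solve-∀

weighted-AM-GM : ∀ n x y → suc n ^ suc n * x ^ n * y ≤ (n * x + y) ^ suc n
weighted-AM-GM n x y = subst (_≤ (n * x + y) ^ suc n) (sym normalise) (case (≤-total x y))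
  where
  open ≤-Reasoning
  t : ℕ
  t = suc n * x
  normalise : suc n ^ suc n * x ^ n * y ≡ suc n * t ^ n * y
  normalise = begin-equality
    suc n * suc n ^ n * x ^ n * y   ≡⟨ cong (_* y) (*-assoc (suc n) (suc n ^ n) (x ^ n)) ⟩
    suc n * (suc n ^ n * x ^ n) * y ≡⟨ cong (λ z → suc n * z * y) (sym (^-distribʳ-* (suc n) x n)) ⟩
    suc n * t ^ n * y               ∎
  sucn*t^n*x≡t^sucn : suc n * t ^ n * x ≡ t ^ suc n
  sucn*t^n*x≡t^sucn = rearrange (suc n) (t ^ n) x
    where
    rearrange : ∀ c X x → c * X * x ≡ c * x * X
    rearrange = solve-∀
  case : x ≤ y ⊎ y ≤ x → suc n * t ^ n * y ≤ (n * x + y) ^ suc n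
  case (inj₁ x≤y) = let e = y ∸ x in begin
    suc n * t ^ n * y                         ≡⟨ cong (suc n * t ^ n *_) (sym (m+[n∸m]≡n x≤y)) ⟩
    suc n * t ^ n * (x + e)                   ≡⟨ *-distribˡ-+ (suc n * t ^ n) x e ⟩
    suc n * t ^ n * x + suc n * t ^ n * e     ≡⟨ cong (_+ suc n * t ^ n * e) sucn*t^n*x≡t^sucn ⟩
    t ^ suc n + suc n * t ^ n * e             ≤⟨ bernoulli t e n ⟩
    (t + e) ^ suc n                           ≡⟨ cong (λ z → (z + e) ^ suc n) (+-comm x (n * x)) ⟩
    (n * x + x + e) ^ suc n                   ≡⟨ cong (_^ suc n) (+-assoc (n * x) x e) ⟩
    (n * x + (x + e)) ^ suc n                 ≡⟨ cong (λ z → (n * x + z) ^ suc n) (m+[n∸m]≡n x≤y) ⟩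
    (n * x + y) ^ suc n                       ∎
  case (inj₂ y≤x) = +-cancelʳ-≤ (suc n * t ^ n * e) _ _ (begin
    suc n * t ^ n * y + suc n * t ^ n * e     ≡⟨ sym (*-distribˡ-+ (suc n * t ^ n) y e) ⟩
    suc n * t ^ n * (y + e)                   ≡⟨ cong (suc n * t ^ n *_) (m+[n∸m]≡n y≤x) ⟩
    suc n * t ^ n * x                         ≡⟨ sucn*t^n*x≡t^sucn ⟩
    t ^ suc n                                 ≤⟨ bernoulli′ t (n * x + y) e n nx+y+e≡t ⟩
    (n * x + y) ^ suc n + suc n * t ^ n * e   ∎)
    where
    e : ℕ
    e = x ∸ y
    nx+y+e≡t : n * x + y + e ≡ t
    nx+y+e≡t = trans (+-assoc (n * x) y e) (trans (cong (n * x +_) (m+[n∸m]≡n y≤x)) (+-comm (n * x) x))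

AM-GM-step : ∀ N S t → suc N ^ suc N * S ^ N * t ≤ N ^ N * (S + t) ^ suc N
AM-GM-step zero    S t = ≤-trans (≤-reflexive (+-identityʳ t))
  (≤-trans (m≤n+m t S) (≤-reflexive (sym (trans (+-identityʳ _) (*-identityʳ (S + t))))))
AM-GM-step N@(suc _) S t = *-cancelˡ-≤ N (begin
  N * (suc N ^ suc N * S ^ N * t)      ≡⟨ rearrange N (suc N ^ suc N) (S ^ N) t ⟩
  suc N ^ suc N * S ^ N * (N * t)      ≤⟨ weighted-AM-GM N S (N * t) ⟩
  (N * S + N * t) ^ suc N              ≡⟨ cong (_^ suc N) (sym (*-distribˡ-+ N S t)) ⟩
  (N * (S + t)) ^ suc N                ≡⟨ ^-distribʳ-* N (S + t) (suc N) ⟩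
  N * N ^ N * (S + t) ^ suc N          ≡⟨ *-assoc N (N ^ N) ((S + t) ^ suc N) ⟩
  N * (N ^ N * (S + t) ^ suc N)        ∎)
  where
  open ≤-Reasoning
  rearrange : ∀ M P X t → M * (P * X * t) ≡ P * X * (M * t)
  rearrange = solve-∀

AM-GM : ∀ (f : A → ℕ) xs → length xs ^ length xs * ∏ xs f ≤ ∑ xs f ^ length xs
AM-GM f []       = ≤-refl
AM-GM f (x ∷ xs) = *-cancelˡ-≤ (N ^ N) {{n^n-nonZero N}} (begin
  N ^ N * (suc N ^ suc N * (f x * ∏ xs f))   ≡⟨ rearrange₁ (N ^ N) (suc N ^ suc N) (f x) (∏ xs f) ⟩
  suc N ^ suc N * f x * (N ^ N * ∏ xs f)     ≤⟨ *-monoʳ-≤ (suc N ^ suc N * f x) (AM-GM f xs) ⟩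
  suc N ^ suc N * f x * ∑ xs f ^ N           ≡⟨ rearrange₂ (suc N ^ suc N) (f x) (∑ xs f ^ N) ⟩
  suc N ^ suc N * ∑ xs f ^ N * f x           ≤⟨ AM-GM-step N (∑ xs f) (f x) ⟩
  N ^ N * (∑ xs f + f x) ^ suc N             ≡⟨ cong (λ z → N ^ N * z ^ suc N) (+-comm (∑ xs f) (f x)) ⟩
  N ^ N * (f x + ∑ xs f) ^ suc N             ∎)
  where
  open ≤-Reasoning
  N : ℕ
  N = length xs
  rearrange₁ : ∀ a b t P → a * (b * (t * P)) ≡ b * t * (a * P)
  rearrange₁ = solve-∀
  rearrange₂ : ∀ b t X → b * t * X ≡ b * X * t
  rearrange₂ = solve-∀

∑-^-lowerBound : ∀ (f : A → ℕ) n .{{_ : NonZero n}} {c} xs →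
  (∀ {x} → x ∈ xs → c ≤ f x ^ n) → length xs ^ n * c ≤ ∑ xs f ^ n
∑-^-lowerBound f n@(suc _) []       _  = z≤n
∑-^-lowerBound {A = A} f n {c} xs@(x ∷ xs′) lb = begin
  length xs ^ n * c             ≤⟨ *-monoʳ-≤ (length xs ^ n) c≤min^n ⟩
  length xs ^ n * f x₀ ^ n      ≡⟨ sym (^-distribʳ-* (length xs) (f x₀) n) ⟩
  (length xs * f x₀) ^ n        ≤⟨ ^-monoˡ-≤ n (∑-≥-const xs min≤) ⟩
  ∑ xs f ^ n                    ∎
  where
  open ≤-Reasoning
  x₀ : A
  x₀ = argmin f x xs′
  c≤min^n : c ≤ f x₀ ^ n
  c≤min^n = argmin-all f {P = λ y → c ≤ f y ^ n} (lb (here refl)) (All.tabulate (λ m → lb (there m)))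
  min≤ : ∀ {y} → y ∈ xs → f x₀ ≤ f y
  min≤ (here refl) = f[argmin]≤f[⊤] {f = f} x xs′
  min≤ (there m)   = All.lookup (f[argmin]≤f[xs] {f = f} x xs′) m

-- Double counting

double-counting : ∀ (W : List A) (D : List I) (Y : List B) (R : I → A → B → Bool) {k b} →
  .{{_ : NonZero (length D)}} →
  (∀ {d} → d ∈ D → ∀ y → count (λ x → R d x y) W ≤ k) →
  (∀ {x} → x ∈ W → b ≤ ∏[ d ∈ D ] count (R d x) Y) →
  length W ^ length D * b ≤ k ^ length D * length Y ^ length D
double-counting {A = A} W D Y R {k} {b} fibre≤k b≤∏ = *-cancelˡ-≤ (N ^ N) {{n^n-nonZero N}} (begin
  N ^ N * (length W ^ N * b)         ≡⟨ x∙yz≈y∙xz (N ^ N) (length W ^ N) b ⟩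
  length W ^ N * (N ^ N * b)         ≤⟨ ∑-^-lowerBound S N W lowerBound ⟩
  ∑ W S ^ N                          ≤⟨ ^-monoˡ-≤ N upperBound ⟩
  (N * (length Y * k)) ^ N           ≡⟨ ^-distribʳ-* N (length Y * k) N ⟩
  N ^ N * (length Y * k) ^ N         ≡⟨ cong (N ^ N *_) (trans (^-distribʳ-* (length Y) k N) (*-comm (length Y ^ N) (k ^ N))) ⟩
  N ^ N * (k ^ N * length Y ^ N)     ∎)
  where
  open ≤-Reasoning
  N : ℕ
  N = length D
  S : A → ℕ
  S x = ∑[ d ∈ D ] count (R d x) Y
  lowerBound : ∀ {x} → x ∈ W → N ^ N * b ≤ S x ^ N
  lowerBound {x} x∈W = ≤-trans (*-monoʳ-≤ (N ^ N) (b≤∏ x∈W)) (AM-GM (λ d → count (R d x) Y) D)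
  upperBound : ∑ W S ≤ N * (length Y * k)
  upperBound = begin
    ∑[ x ∈ W ] ∑[ d ∈ D ] count (R d x) Y                         ≡⟨ ∑-swap _ W D ⟩
    ∑[ d ∈ D ] ∑[ x ∈ W ] ∑[ y ∈ Y ] (if R d x y then 1 else 0)   ≡⟨ ∑-cong D (λ _ → ∑-swap _ W Y) ⟩
    ∑[ d ∈ D ] ∑[ y ∈ Y ] count (λ x → R d x y) W                 ≤⟨ ∑-≤-const D (λ d∈D → ∑-≤-const Y (λ _ → fibre≤k d∈D _)) ⟩
    N * (length Y * k)                                             ∎

choices : List (List A) → List (List A)
choices []       = [] ∷ []
choices (S ∷ Ss) = cartesianProductWith _∷_ S (choices Ss)

length-choices : ∀ (G : A → List B) xs → length (choices (map G xs)) ≡ ∏[ x ∈ xs ] length (G x)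
length-choices G []       = refl
length-choices G (x ∷ xs) = trans (length-cartesianProductWith _∷_ (G x) (choices (map G xs)))
                                  (cong (length (G x) *_) (length-choices G xs))

pointwise : (A → B → Bool) → List A → List B → Bool
pointwise R []       []       = true
pointwise R (x ∷ xs) (y ∷ ys) = R x y ∧ pointwise R xs ys
pointwise R _        _        = false

count-choices : ∀ (R : A → B → Bool) (G : A → List B) xs →
  count (pointwise R xs) (choices (map G xs)) ≡ ∏[ x ∈ xs ] count (R x) (G x)
count-choices R G []       = refl
count-choices R G (x ∷ xs) = trans
  (count-cartesianProductWith _∷_ (λ _ _ → refl) (G x) (choices (map G xs)))
  (cong (count (R x) (G x) *_) (count-choices R G xs))

pointwise-common : ∀ {R R′ : A → B → Bool} {xs ys} → T (pointwise R xs ys) → T (pointwise R′ xs ys) →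
  ∀ {x} → x ∈ xs → ∃ λ y → T (R x y) × T (R′ x y)
pointwise-common {R = R} {R′} {x ∷ xs} {y ∷ ys} t t′ (here refl) =
  y , proj₁ (Equivalence.to (T-∧ {R x y}) t) , proj₁ (Equivalence.to (T-∧ {R′ x y}) t′)
pointwise-common {R = R} {R′} {x ∷ xs} {y ∷ ys} t t′ (there x∈xs) =
  pointwise-common (proj₂ (Equivalence.to (T-∧ {R x y}) t)) (proj₂ (Equivalence.to (T-∧ {R′ x y}) t′)) x∈xs

-- Divisors, valuations and primes

module _ {Q : ℕ → Set} (Q? : Decidable Q) (Q-down : ∀ {v w} → v ≤ w → Q w → Q v) where

  private
    countUpTo : ℕ → ℕ
    countUpTo D = length (filter Q? (map suc (upTo D)))

    countUpTo-all : ∀ D → Q D → countUpTo D ≡ D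
    countUpTo-all D QD = begin
      length (filter Q? (map suc (upTo D)))  ≡⟨ cong length (Listₚ.filter-all Q? (All.tabulate below)) ⟩
      length (map suc (upTo D))              ≡⟨ length-map suc (upTo D) ⟩
      length (upTo D)                        ≡⟨ length-upTo D ⟩
      D                                      ∎
      where
      open ≡-Reasoning
      below : ∀ {w} → w ∈ map suc (upTo D) → Q w
      below w∈ with ∈-map⁻ suc w∈
      ... | u , u∈ , refl = Q-down (∈-upTo⁻ u∈) QD

    countUpTo-skip : ∀ D → ¬ Q (suc D) → countUpTo (suc D) ≡ countUpTo D
    countUpTo-skip D ¬Q = begin
      length (filter Q? (map suc (upTo (suc D))))                        ≡⟨ cong (λ l → length (filter Q? (map suc l))) (sym (upTo-∷ʳ D)) ⟩
      length (filter Q? (map suc (upTo D ∷ʳ D)))                         ≡⟨ cong (λ l → length (filter Q? l)) (map-++ suc (upTo D) (D ∷ [])) ⟩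
      length (filter Q? (map suc (upTo D) ++ suc D ∷ []))                ≡⟨ cong length (Listₚ.filter-++ Q? (map suc (upTo D)) (suc D ∷ [])) ⟩
      length (filter Q? (map suc (upTo D)) ++ filter Q? (suc D ∷ []))    ≡⟨ length-++ (filter Q? (map suc (upTo D))) ⟩
      countUpTo D + length (filter Q? (suc D ∷ []))                      ≡⟨ cong (λ l → countUpTo D + length l) (Listₚ.filter-reject Q? ¬Q) ⟩
      countUpTo D + 0                                                    ≡⟨ +-identityʳ _ ⟩
      countUpTo D                                                        ∎
      where open ≡-Reasoning

  ≤countUpTo⇔ : ∀ D {v} → 1 ≤ v → v ≤ length (filter Q? (map suc (upTo D))) ⇔ (Q v × v ≤ D)
  ≤countUpTo⇔ zero    1≤v = mk⇔ (λ v≤0 → ⊥-elim (<⇒≱ 1≤v v≤0)) (λ (_ , v≤0) → ⊥-elim (<⇒≱ 1≤v v≤0))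
  ≤countUpTo⇔ (suc D) {v} 1≤v with Q? (suc D)
  ... | yes QsD = mk⇔
    (λ v≤c → let v≤sD = subst (v ≤_) (countUpTo-all (suc D) QsD) v≤c in Q-down v≤sD QsD , v≤sD)
    (λ (_ , v≤sD) → subst (v ≤_) (sym (countUpTo-all (suc D) QsD)) v≤sD)
  ... | no ¬QsD = mk⇔
    (λ v≤c → Product.map₂ m≤n⇒m≤1+n (Equivalence.to (≤countUpTo⇔ D 1≤v) (subst (v ≤_) (countUpTo-skip D ¬QsD) v≤c)))
    (λ (Qv , v≤sD) → subst (v ≤_) (sym (countUpTo-skip D ¬QsD)) (Equivalence.from (≤countUpTo⇔ D 1≤v) (Qv , v≤D Qv v≤sD)))
    where
    v≤D : Q v → v ≤ suc D → v ≤ D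
    v≤D Qv v≤sD with m≤n⇒m<n∨m≡n v≤sD
    ... | inj₁ v<sD = ≤-pred v<sD
    ... | inj₂ refl = ⊥-elim (¬QsD Qv)

n<m^n : ∀ m n → 1 < m → n < m ^ n
n<m^n m zero    _   = s≤s z≤n
n<m^n m (suc n) 1<m = begin-strict
  suc n          <⟨ s≤s (n<m^n m n 1<m) ⟩
  suc (m ^ n)    ≤⟨ +-monoˡ-≤ (m ^ n) (m^n>0 m n) ⟩
  m ^ n + m ^ n  ≡⟨ cong (m ^ n +_) (sym (+-identityʳ (m ^ n))) ⟩
  2 * m ^ n      ≤⟨ *-monoˡ-≤ (m ^ n) 1<m ⟩
  m * m ^ n      ∎
  where
  open ≤-Reasoning
  instance
    m≢0 : NonZero m
    m≢0 = >-nonZero (<-trans (s≤s z≤n) 1<m)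

prime>1 : Prime p → 1 < p
prime>1 {p} pp = Data.Nat.nonTrivial⇒n>1 p {{prime⇒nonTrivial pp}}

^∣⇔≤val : Prime p → 1 ≤ d → ∀ v → p ^ v ∣ d ⇔ v ≤ val p d
^∣⇔≤val {p} {d} _  _   zero    = mk⇔ (λ _ → z≤n) (λ _ → 1∣ d)
^∣⇔≤val {p} {d} pp 1≤d (suc v) = mk⇔
  (λ p^v∣d → Equivalence.from ≤val⇔ (p^v∣d , ≤-trans (<⇒≤ (n<m^n p (suc v) (prime>1 pp))) (∣⇒≤ p^v∣d)))
  (λ v≤val → proj₁ (Equivalence.to ≤val⇔ v≤val))
  where
  instance
    d≢0 : NonZero d
    d≢0 = >-nonZero 1≤d
  ^-∣ : ∀ {v w} → v ≤ w → p ^ v ∣ p ^ w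
  ^-∣ z≤n       = 1∣ _
  ^-∣ (s≤s v≤w) = *-monoʳ-∣ p (^-∣ v≤w)
  ≤val⇔ : suc v ≤ val p d ⇔ (p ^ suc v ∣ d × suc v ≤ d)
  ≤val⇔ = ≤countUpTo⇔ (λ w → p ^ w ∣? d) (λ v≤w p^w∣d → ∣-trans (^-∣ v≤w) p^w∣d) d (s≤s (z≤n {v}))

val≥1 : Prime p → 1 ≤ d → p ∣ d → 1 ≤ val p d
val≥1 {p} {d} pp 1≤d p∣d = Equivalence.to (^∣⇔≤val pp 1≤d 1) (subst (_∣ d) (sym (*-identityʳ p)) p∣d)

val≡0 : Prime p → 1 ≤ d → ¬ p ∣ d → val p d ≡ 0
val≡0 {p} {d} pp 1≤d p∤d with val p d in eq
... | zero  = refl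
... | suc _ = ⊥-elim (p∤d (subst (_∣ d) (*-identityʳ p)
                (Equivalence.from (^∣⇔≤val pp 1≤d 1) (subst (1 ≤_) (sym eq) (s≤s z≤n)))))

prime∣prime⇒≡ : Prime p → Prime q → p ∣ q → p ≡ q
prime∣prime⇒≡ pp pq p∣q with prime⇒irreducible pq p∣q
... | inj₁ refl = ⊥-elim (¬prime[1] pp)
... | inj₂ p≡q  = p≡q

prime∣^⇒∣ : Prime p → ∀ m v → p ∣ m ^ v → p ∣ m
prime∣^⇒∣ pp _ zero    p∣1 = ⊥-elim (¬prime[1] (subst Prime (∣1⇒≡1 p∣1) pp))
prime∣^⇒∣ pp m (suc v) p∣m^sv with euclidsLemma m (m ^ v) pp p∣m^sv
... | inj₁ p∣m   = p∣m
... | inj₂ p∣m^v = prime∣^⇒∣ pp m v p∣m^v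

^-coprime-prime : Prime p → Prime q → q ≢ p → ∀ v → Coprime (q ^ v) p
^-coprime-prime pp pq q≢p v (i∣q^v , i∣p) with prime⇒irreducible pp i∣p
... | inj₁ i≡1  = i≡1
... | inj₂ refl = ⊥-elim (q≢p (sym (prime∣prime⇒≡ pp pq (prime∣^⇒∣ pp _ v i∣q^v))))

product-∣ : ∀ {fs} → All Prime fs → (∀ {p} v → Prime p → p ^ v ∣ product fs → p ^ v ∣ b) → product fs ∣ b
product-∣ []                    _   = 1∣ _
product-∣ {b} {p ∷ fs} (pp ∷ fsPrime) ppow
  with ppow 1 pp (subst (_∣ p * product fs) (sym (*-identityʳ p)) (m∣m*n (product fs)))
... | divides q b≡q*p¹ = subst (p * product fs ∣_) (sym b≡p*q) (*-monoʳ-∣ p (product-∣ fsPrime ppow′))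
  where
  instance
    p≢0 : NonZero p
    p≢0 = prime⇒nonZero pp
  b≡p*q : b ≡ p * q
  b≡p*q = trans b≡q*p¹ (trans (cong (q *_) (*-identityʳ p)) (*-comm q p))
  ppow′ : ∀ {r} v → Prime r → r ^ v ∣ product fs → r ^ v ∣ q
  ppow′ {r} v pr r^v∣ with r ≟ p
  ... | yes refl = *-cancelˡ-∣ p (subst (p ^ suc v ∣_) b≡p*q (ppow (suc v) pr (*-monoʳ-∣ p r^v∣)))
  ... | no r≢p   = coprime-divisor (^-coprime-prime pp pr r≢p v)
                     (subst (r ^ v ∣_) b≡p*q (ppow v pr (∣-trans r^v∣ (n∣m*n p))))

∣-fromPrimePowers : 1 ≤ a → (∀ {p} v → Prime p → p ^ v ∣ a → p ^ v ∣ b) → a ∣ b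
∣-fromPrimePowers {a} {b} 1≤a ppow =
  subst (_∣ b) (sym a≡∏) (product-∣ (factorsPrime f) (λ v pp p^v∣∏ → ppow v pp (subst (_ ∣_) (sym a≡∏) p^v∣∏)))
  where
  open PrimeFactorisation using (factors; factorsPrime; isFactorisation)
  f : PrimeFactorisation a
  f = factorise a {{>-nonZero 1≤a}}
  a≡∏ : a ≡ product (factors f)
  a≡∏ = isFactorisation f

∈-primeDivisors⁻ : ∀ n → p ∈ primeDivisors n → Prime p × p ∣ n
∈-primeDivisors⁻ n p∈ with ∈-filter⁻ prime? p∈
... | p∈′ , pp = pp , proj₂ (∈-filter⁻ (_∣? n) {xs = upTo (suc n)} p∈′)

∈-primeDivisors⁺ : 1 ≤ n → Prime p → p ∣ n → p ∈ primeDivisors n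
∈-primeDivisors⁺ {n} 1≤n pp p∣n =
  ∈-filter⁺ prime? (∈-filter⁺ (_∣? n) (∈-upTo⁺ (s≤s (∣⇒≤ {{>-nonZero 1≤n}} p∣n))) p∣n) pp

∣⇒≥1 : 1 ≤ n → d ∣ n → 1 ≤ d
∣⇒≥1 {d = zero}  1≤n 0∣n = subst (1 ≤_) (0∣⇒≡0 0∣n) 1≤n
∣⇒≥1 {d = suc d} _   _   = s≤s z≤n

∣-fromPrimePowersOf : 1 ≤ n → a ∣ n →
  (∀ {p} v → p ∈ primeDivisors n → p ^ suc v ∣ a → p ^ suc v ∣ b) → a ∣ b
∣-fromPrimePowersOf {n} {a} {b} 1≤n a∣n ppow = ∣-fromPrimePowers (∣⇒≥1 1≤n a∣n) ppow′
  where
  ppow′ : ∀ {p} v → Prime p → p ^ v ∣ a → p ^ v ∣ b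
  ppow′         zero    _  _       = 1∣ b
  ppow′ {p = p} (suc v) pp p^sv∣a =
    ppow v (∈-primeDivisors⁺ 1≤n pp (∣-trans (∣-trans (m∣m*n (p ^ v)) p^sv∣a) a∣n)) p^sv∣a

val-mono : Prime p → 1 ≤ n → d ∣ n → val p d ≤ val p n
val-mono {p} {n} {d} pp 1≤n d∣n = Equivalence.to (^∣⇔≤val pp 1≤n (val p d))
  (∣-trans (Equivalence.from (^∣⇔≤val pp (∣⇒≥1 1≤n d∣n) (val p d)) ≤-refl) d∣n)

≡-fromValuations : 1 ≤ n → a ∣ n → b ∣ n →
  (∀ {p} → p ∈ primeDivisors n → val p a ≡ val p b) → a ≡ b
≡-fromValuations {n} 1≤n a∣n b∣n val≡ =
  ∣-antisym (transfer a∣n b∣n val≡) (transfer b∣n a∣n (λ p∈ → sym (val≡ p∈)))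
  where
  transfer : ∀ {a b} → a ∣ n → b ∣ n → (∀ {p} → p ∈ primeDivisors n → val p a ≡ val p b) → a ∣ b
  transfer a∣n b∣n val≡ = ∣-fromPrimePowersOf 1≤n a∣n λ {p} v p∈ p^sv∣a →
    let pp = proj₁ (∈-primeDivisors⁻ n p∈) in
    Equivalence.from (^∣⇔≤val pp (∣⇒≥1 1≤n b∣n) (suc v))
      (subst (suc v ≤_) (val≡ p∈) (Equivalence.to (^∣⇔≤val pp (∣⇒≥1 1≤n a∣n) (suc v)) p^sv∣a))

squarefree-¬p²∣ : Squarefree n → Prime p → d ∣ n → ∀ v → ¬ p ^ suc (suc v) ∣ d
squarefree-¬p²∣ {p = p} sq pp d∣n v p^ssv∣d =
  sq p pp (∣-trans (*-monoʳ-∣ p (m∣m*n (p ^ v))) (∣-trans p^ssv∣d d∣n))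

≡-fromPrimeDivisors : 1 ≤ n → Squarefree n → a ∣ n → b ∣ n →
  (∀ {p} → p ∈ primeDivisors n → p ∣ a ⇔ p ∣ b) → a ≡ b
≡-fromPrimeDivisors {n} 1≤n sq a∣n b∣n ∣⇔∣ =
  ∣-antisym (transfer a∣n (Equivalence.to ∘ ∣⇔∣)) (transfer b∣n (Equivalence.from ∘ ∣⇔∣))
  where
  transfer : ∀ {a b} → a ∣ n → (∀ {p} → p ∈ primeDivisors n → p ∣ a → p ∣ b) → a ∣ b
  transfer {a} {b} a∣n ∣⇒∣ = ∣-fromPrimePowersOf 1≤n a∣n ppow
    where
    ppow : ∀ {p} v → p ∈ primeDivisors n → p ^ suc v ∣ a → p ^ suc v ∣ b
    ppow {p} zero    p∈ p¹∣a   = subst (_∣ b) (sym (*-identityʳ p)) (∣⇒∣ p∈ (subst (_∣ a) (*-identityʳ p) p¹∣a))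
    ppow     (suc v) p∈ p^ssv∣a = ⊥-elim (squarefree-¬p²∣ sq (proj₁ (∈-primeDivisors⁻ n p∈)) a∣n v p^ssv∣a)

coprime-*-∣ : ∀ {a b n} → Coprime a b → a ∣ n → b ∣ n → a * b ∣ n
coprime-*-∣ {a} {b} coprime (divides q refl) b∣q*a =
  subst (a * b ∣_) (*-comm a q) (*-monoʳ-∣ a (coprime-divisor (Coprime.sym coprime) (subst (b ∣_) (*-comm q a) b∣q*a)))

prime∣*⇔ : ∀ {p} x y → Prime p → p ∣ x * y ⇔ (p ∣ x ⊎ p ∣ y)
prime∣*⇔ x y pp = mk⇔ (euclidsLemma x y pp) [ (λ p∣x → ∣-trans p∣x (m∣m*n y)) , (λ p∣y → ∣-trans p∣y (n∣m*n x)) ]′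

-- Extended tuples and fibres of regular maps

lookup-ext : ∀ {u u′ : Vec A m} → (∀ i → lookup u i ≡ lookup u′ i) → u ≡ u′
lookup-ext {u = u} {u′} eq = trans (sym (Vecₚ.tabulate∘lookup u)) (trans (Vecₚ.tabulate-cong eq) (Vecₚ.tabulate∘lookup u′))

[]≔-lookup-agree : ∀ (t u : Vec A m) i → (∀ i′ → i′ ≢ i → lookup t i′ ≡ lookup u i′) → t [ i ]≔ lookup u i ≡ u
[]≔-lookup-agree t u i agree = lookup-ext λ i′ → case i′
  where
  case : ∀ i′ → lookup (t [ i ]≔ lookup u i) i′ ≡ lookup u i′
  case i′ with i′ Fin.≟ i
  ... | yes refl = Vecₚ.lookup∘update i t (lookup u i)
  ... | no i′≢i  = trans (Vecₚ.lookup∘update′ i′≢i t (lookup u i)) (agree i′ i′≢i)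

[]≔-lookup-agree₂ : ∀ (t u : Vec A m) i₁ i₂ → (∀ i′ → i′ ≢ i₁ → i′ ≢ i₂ → lookup t i′ ≡ lookup u i′) →
  (t [ i₁ ]≔ lookup u i₁) [ i₂ ]≔ lookup u i₂ ≡ u
[]≔-lookup-agree₂ t u i₁ i₂ agree = []≔-lookup-agree _ u i₂ agree′
  where
  agree′ : ∀ i′ → i′ ≢ i₂ → lookup (t [ i₁ ]≔ lookup u i₁) i′ ≡ lookup u i′
  agree′ i′ i′≢i₂ with i′ Fin.≟ i₁
  ... | yes refl = Vecₚ.lookup∘update i₁ t (lookup u i₁)
  ... | no i′≢i₁ = trans (Vecₚ.lookup∘update′ i′≢i₁ t (lookup u i₁)) (agree i′ i′≢i₁ i′≢i₂)

AtMost-image : ∀ {k} {Q : B → Set} → AtMost k Q → (f : A → B) (r : B → A) → ∀ {xs} → Unique xs →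
  (∀ {x} → x ∈ xs → r (f x) ≡ x) → (∀ {x} → x ∈ xs → Q (f x)) → length xs ≤ k
AtMost-image {k = k} {Q} atMost f r {xs} uniq r∘f≡id Qf =
  subst (_≤ k) (length-map f xs) (atMost (map f xs) (map-unique uniq r∘f≡id) (All.tabulate Q-image))
  where
  Q-image : ∀ {y} → y ∈ map f xs → Q y
  Q-image y∈ with ∈-map⁻ f y∈
  ... | x , x∈ , refl = Qf x∈
  notIn : ∀ {x xs} → All (x ≢_) xs → ∀ {y} → y ∈ xs → x ≢ y
  notIn (x≢ ∷ _)   (here refl) = x≢
  notIn (_ ∷ x≢s)  (there y∈)  = notIn x≢s y∈
  map-unique : ∀ {xs} → Unique xs → (∀ {x} → x ∈ xs → r (f x) ≡ x) → Unique (map f xs)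
  map-unique []                 _   = []
  map-unique {x ∷ xs} (x∉ ∷ uniq) inv =
    All.tabulate (λ y∈ fx≡y → fresh y∈ fx≡y) ∷ map-unique uniq (λ x∈ → inv (there x∈))
    where
    fresh : ∀ {y} → y ∈ map f xs → f x ≢ y
    fresh y∈ fx≡y with ∈-map⁻ f y∈
    ... | x′ , x′∈ , refl = notIn x∉ x′∈ (trans (sym (inv (here refl))) (trans (cong r fx≡y) (inv (there x′∈))))

Unique-allEqual-length≤1 : ∀ {xs : List A} → Unique xs → (∀ {x y} → x ∈ xs → y ∈ xs → x ≡ y) → length xs ≤ 1
Unique-allEqual-length≤1 {xs = []}         _                  _   = z≤n
Unique-allEqual-length≤1 {xs = _ ∷ []}     _                  _   = s≤s z≤n
Unique-allEqual-length≤1 {xs = _ ∷ _ ∷ _} ((x≢y ∷ _) ∷ _) allEq = ⊥-elim (x≢y (allEq (here refl) (there (here refl))))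

extend : ∀ {j} → (Vec ℕ j → ℕ) → Vec ℕ j → Vec ℕ (suc j)
extend g u = g u ∷ u

AgreeOff : (Fin m → Set) → Vec ℕ m → Vec ℕ m → Set
AgreeOff S x x′ = ∀ c → ¬ S c → lookup x c ≡ lookup x′ c

module _ {n j k : ℕ} {U : RegularSet n j} {g : Vec ℕ j → ℕ} where

  extend-∣ : KRegular n j k U g → ∀ {u} → u ∈ elems U → ∀ c → lookup (extend g u) c ∣ n
  extend-∣ KR u∈ zero    = KRegular.codomain KR _ u∈
  extend-∣ KR u∈ (suc i) = All.lookup (divisors U) u∈ i

  extend-coprime : KRegular n j k U g → ∀ {u} → u ∈ elems U → ∀ c c′ → c ≢ c′ →
    Coprime (lookup (extend g u) c) (lookup (extend g u) c′)
  extend-coprime KR u∈ zero    zero     c≢c′ = ⊥-elim (c≢c′ refl)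
  extend-coprime KR u∈ zero    (suc i)  _    = KRegular.cond0 KR _ u∈ i
  extend-coprime KR u∈ (suc i) zero     _    = Coprime.sym (KRegular.cond0 KR _ u∈ i)
  extend-coprime KR u∈ (suc i) (suc i′) c≢c′ = All.lookup (regular U) u∈ i i′ (λ i≡i′ → c≢c′ (cong suc i≡i′))

  extend-prime-unique : KRegular n j k U g → ∀ {u} → u ∈ elems U → ∀ {p} → Prime p → ∀ {c c′} →
    p ∣ lookup (extend g u) c → p ∣ lookup (extend g u) c′ → c ≡ c′
  extend-prime-unique KR u∈ pp {c} {c′} p∣ p∣′ with c Fin.≟ c′
  ... | yes c≡c′ = c≡c′
  ... | no c≢c′  = ⊥-elim (¬prime[1] (subst Prime (extend-coprime KR u∈ c c′ c≢c′ (p∣ , p∣′)) pp))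

  Agree₂ : Fin (suc j) → Fin (suc j) → Vec ℕ j → Vec ℕ j → Set
  Agree₂ c₁ c₂ u u′ = AgreeOff (λ c → c ≡ c₁ ⊎ c ≡ c₂) (extend g u) (extend g u′) ×
                      lookup (extend g u) c₁ * lookup (extend g u) c₂ ≡ lookup (extend g u′) c₁ * lookup (extend g u′) c₂

  module _ (Q : Vec ℕ j → Set) where

    Fibre : Vec ℕ j → Set
    Fibre u = u ∈ elems U × Q u

    fibre-atMost₁ : KRegular n j k U g → 1 ≤ k → ∀ c →
      (∀ {u u′} → Fibre u → Fibre u′ → AgreeOff (_≡ c) (extend g u) (extend g u′)) → AtMost k Fibre
    fibre-atMost₁ _ _ _ _ [] _ _ = z≤n
    fibre-atMost₁ KR 1≤k zero agree us@(u₀ ∷ _) uniq inFibre =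
      ≤-trans (Unique-allEqual-length≤1 uniq λ u∈ u′∈ →
                 lookup-ext λ i → agree (All.lookup inFibre u∈) (All.lookup inFibre u′∈) (suc i) (λ ()))
              1≤k
    fibre-atMost₁ KR 1≤k (suc i) agree us@(u₀ ∷ _) uniq inFibre =
      AtMost-image (KRegular.cond1 KR u₀ i (g u₀)) (λ u → lookup u i) (u₀ [ i ]≔_) uniq inv image
      where
      agree₀ : ∀ {u} → u ∈ us → AgreeOff (_≡ suc i) (extend g u₀) (extend g u)
      agree₀ u∈ = agree (All.lookup inFibre (here refl)) (All.lookup inFibre u∈)
      inv : ∀ {u} → u ∈ us → u₀ [ i ]≔ lookup u i ≡ u
      inv u∈ = []≔-lookup-agree u₀ _ i (λ i′ i′≢i → agree₀ u∈ (suc i′) (i′≢i ∘ Finₚ.suc-injective))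
      image : ∀ {u} → u ∈ us → (u₀ [ i ]≔ lookup u i) ∈ elems U × g (u₀ [ i ]≔ lookup u i) ≡ g u₀
      image u∈ rewrite inv u∈ = proj₁ (All.lookup inFibre u∈) , sym (agree₀ u∈ zero (λ ()))

    fibre-atMost₂ : StronglyKRegular n j k U g → ∀ {c₁ c₂} → c₁ Fin.< c₂ →
      (∀ {u u′} → Fibre u → Fibre u′ → Agree₂ c₁ c₂ u u′) → AtMost k Fibre
    fibre-atMost₂ _ _ _ [] _ _ = z≤n
    fibre-atMost₂ SR {zero} {suc i} _ agree us@(u₀ ∷ _) uniq inFibre =
      AtMost-image (KRegular.cond2 (StronglyKRegular.kregular SR) u₀ i (lookup u₀ i * g u₀))
        (λ u → lookup u i) (u₀ [ i ]≔_) uniq inv image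
      where
      agree₀ : ∀ {u} → u ∈ us → Agree₂ zero (suc i) u₀ u
      agree₀ u∈ = agree (All.lookup inFibre (here refl)) (All.lookup inFibre u∈)
      inv : ∀ {u} → u ∈ us → u₀ [ i ]≔ lookup u i ≡ u
      inv u∈ = []≔-lookup-agree u₀ _ i (λ i′ i′≢i →
        proj₁ (agree₀ u∈) (suc i′) [ (λ ()) , i′≢i ∘ Finₚ.suc-injective ]′)
      image : ∀ {u} → u ∈ us → (u₀ [ i ]≔ lookup u i) ∈ elems U ×
                                lookup u i * g (u₀ [ i ]≔ lookup u i) ≡ lookup u₀ i * g u₀
      image {u} u∈ rewrite inv u∈ = proj₁ (All.lookup inFibre u∈) ,
        trans (*-comm (lookup u i) (g u)) (trans (sym (proj₂ (agree₀ u∈))) (*-comm (g u₀) (lookup u₀ i)))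
    fibre-atMost₂ SR {suc i₁} {suc i₂} (s≤s i₁<i₂) agree us@(u₀ ∷ _) uniq inFibre =
      AtMost-image (StronglyKRegular.cond3 SR u₀ i₁ i₂ i₁<i₂ (g u₀) (lookup u₀ i₁ * lookup u₀ i₂))
        (λ u → lookup u i₁ , lookup u i₂) (λ (z₁ , z₂) → (u₀ [ i₁ ]≔ z₁) [ i₂ ]≔ z₂) uniq inv image
      where
      agree₀ : ∀ {u} → u ∈ us → Agree₂ (suc i₁) (suc i₂) u₀ u
      agree₀ u∈ = agree (All.lookup inFibre (here refl)) (All.lookup inFibre u∈)
      inv : ∀ {u} → u ∈ us → (u₀ [ i₁ ]≔ lookup u i₁) [ i₂ ]≔ lookup u i₂ ≡ u
      inv u∈ = []≔-lookup-agree₂ u₀ _ i₁ i₂ (λ i′ i′≢i₁ i′≢i₂ →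
        proj₁ (agree₀ u∈) (suc i′) [ i′≢i₁ ∘ Finₚ.suc-injective , i′≢i₂ ∘ Finₚ.suc-injective ]′)
      image : ∀ {u} → u ∈ us → let u′ = (u₀ [ i₁ ]≔ lookup u i₁) [ i₂ ]≔ lookup u i₂ in
        u′ ∈ elems U × g u′ ≡ g u₀ × lookup u i₁ * lookup u i₂ ≡ lookup u₀ i₁ * lookup u₀ i₂
      image u∈ rewrite inv u∈ = proj₁ (All.lookup inFibre u∈) ,
        sym (proj₁ (agree₀ u∈) zero [ (λ ()) , (λ ()) ]′) , sym (proj₂ (agree₀ u∈))

-- Part (b)

module PartB {n j k : ℕ} (1≤n : 1 ≤ n) (1≤k : 1 ≤ k) (U : RegularSet n j) {g : Vec ℕ j → ℕ}
             (KR : KRegular n j k U g) where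

  L : ℕ
  L = suc j

  W : List (Vec ℕ j)
  W = elems U

  P : List ℕ
  P = primeDivisors n

  X : Vec ℕ j → Fin L → ℕ
  X u = lookup (extend g u)

  -- A label (l₀ , e) stands for the valuation profile with value 1 + e at l₀ and 0 elsewhere.
  Label : Set
  Label = Fin L × ℕ

  labels : ℕ → List Label
  labels p = cartesianProduct (allFin L) (upTo (val p n))

  profile : Label → Fin L → ℕ
  profile (l₀ , e) l = if isYes (l₀ Fin.≟ l) then suc e else 0

  Fits : Fin L → Vec ℕ j → ℕ → Label → Set
  Fits l u p c = ∀ l′ → l′ ≢ l → val p (X u l′) ≡ profile c l′

  fits? : ∀ l u p c → Dec (Fits l u p c)
  fits? l u p c = Finₚ.all? λ l′ → ¬? (l′ Fin.≟ l) →-dec (val p (X u l′) ≟ profile c l′)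

  fits : Fin L → Vec ℕ j → ℕ → Label → Bool
  fits l u p c = isYes (fits? l u p c)

  compatible : Fin L → Vec ℕ j → List Label → Bool
  compatible l u = pointwise (fits l u) P

  Y : List (List Label)
  Y = choices (map labels P)

  fibre≤k : ∀ {l} → l ∈ allFin L → ∀ y → count (λ u → compatible l u y) W ≤ k
  fibre≤k {l} _ y = count≤-AtMost (unique U) (fibre-atMost₁ (λ u → T (compatible l u y)) KR 1≤k l agree)
    where
    agree : ∀ {u u′} → u ∈ W × T (compatible l u y) → u′ ∈ W × T (compatible l u′ y) →
            AgreeOff (_≡ l) (extend g u) (extend g u′)
    agree (u∈ , cu) (u′∈ , cu′) l′ l′≢l = ≡-fromValuations 1≤n (extend-∣ KR u∈ l′) (extend-∣ KR u′∈ l′) λ p∈ →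
      let (c , fu , fu′) = pointwise-common cu cu′ p∈
      in trans (toWitness fu l′ l′≢l) (sym (toWitness fu′ l′ l′≢l))

  profile-≢ : ∀ {l₀ l} e → l₀ ≢ l → profile (l₀ , e) l ≡ 0
  profile-≢ {l₀} {l} e l₀≢l with l₀ Fin.≟ l
  ... | yes l₀≡l = ⊥-elim (l₀≢l l₀≡l)
  ... | no _     = refl

  val[n]≥1 : ∀ {p} → p ∈ P → 1 ≤ val p n
  val[n]≥1 p∈ = let (pp , p∣n) = ∈-primeDivisors⁻ n p∈ in val≥1 pp 1≤n p∣n

  module _ {u} (u∈ : u ∈ W) {p} (p∈ : p ∈ P) where

    pp : Prime p
    pp = proj₁ (∈-primeDivisors⁻ n p∈)

    X≥1 : ∀ l → 1 ≤ X u l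
    X≥1 l = ∣⇒≥1 1≤n (extend-∣ KR u∈ l)

    ¬∣-others : ∀ {l₀} → p ∣ X u l₀ → ∀ l → l ≢ l₀ → ¬ p ∣ X u l
    ¬∣-others p∣ l l≢l₀ p∣′ = l≢l₀ (extend-prime-unique KR u∈ pp p∣′ p∣)

    row≥val : ∀ l → (∀ l′ → l′ ≢ l → ¬ p ∣ X u l′) → val p n ≤ count (fits l u p) (labels p)
    row≥val l none = begin
      val p n
        ≡⟨ sym (length-upTo (val p n)) ⟩
      length (upTo (val p n))
        ≡⟨ sym (count-all (upTo (val p n)) (λ _ → fromWitness fitsRow)) ⟩
      count (λ e → fits l u p (l , e)) (upTo (val p n))
        ≤⟨ ∑-≥-member (λ l₀ → count (λ e → fits l u p (l₀ , e)) (upTo (val p n))) (∈-allFin l) ⟩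
      ∑[ l₀ ∈ allFin L ] count (λ e → fits l u p (l₀ , e)) (upTo (val p n))
        ≡⟨ sym (∑-cartesianProductWith _ _,_ (allFin L) (upTo (val p n))) ⟩
      count (fits l u p) (labels p)
        ∎
      where
      open ≤-Reasoning
      fitsRow : ∀ {e} → Fits l u p (l , e)
      fitsRow {e} l′ l′≢l = trans (val≡0 pp (X≥1 l′) (none l′ l′≢l)) (sym (profile-≢ e (λ e → l′≢l (sym e))))

    fits≥1 : ∀ l → 1 ≤ count (fits l u p) (labels p)
    fits≥1 l with Finₚ.any? (λ l′ → ¬? (l′ Fin.≟ l) ×-dec (p ∣? X u l′))
    ... | no none = ≤-trans (val[n]≥1 p∈) (row≥val l (λ l′ l′≢l p∣ → none (l′ , l′≢l , p∣)))
    ... | yes (l₀ , l₀≢l , p∣) with val p (X u l₀) in eq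
    ...   | zero  = ⊥-elim (n≮0 (subst (1 ≤_) eq (val≥1 pp (X≥1 l₀) p∣)))
    ...   | suc e = count-≥1 (∈-cartesianProduct⁺ (∈-allFin l₀) (∈-upTo⁺ e<val)) (fromWitness fitsSpike)
      where
      e<val : e < val p n
      e<val = subst (_≤ val p n) eq (val-mono pp 1≤n (extend-∣ KR u∈ l₀))
      fitsSpike : Fits l u p (l₀ , e)
      fitsSpike l′ l′≢l with l₀ Fin.≟ l′
      ... | yes refl = eq
      ... | no l₀≢l′ = val≡0 pp (X≥1 l′) (¬∣-others p∣ l′ (λ e → l₀≢l′ (sym e)))

    ∏-fits≥val : val p n ≤ ∏[ l ∈ allFin L ] count (fits l u p) (labels p)
    ∏-fits≥val with Finₚ.any? (λ l → p ∣? X u l)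
    ... | yes (l₀ , p∣) = ≤-trans (row≥val l₀ (¬∣-others p∣)) (∏-≥-member (λ {l} _ → fits≥1 l) (∈-allFin l₀))
    ... | no none       = ≤-trans (row≥val zero (λ l _ p∣ → none (l , p∣))) (∏-≥-member (λ {l} _ → fits≥1 l) (∈-allFin zero))

  V : ℕ
  V = ∏[ p ∈ P ] val p n

  fibres≥V : ∀ {u} → u ∈ W → V ≤ ∏[ l ∈ allFin L ] count (compatible l u) Y
  fibres≥V {u} u∈ = begin
    ∏[ p ∈ P ] val p n
      ≤⟨ ∏-mono-≤ P (∏-fits≥val u∈) ⟩
    ∏[ p ∈ P ] ∏[ l ∈ allFin L ] count (fits l u p) (labels p)
      ≡⟨ ∏-swap _ P (allFin L) ⟩
    ∏[ l ∈ allFin L ] ∏[ p ∈ P ] count (fits l u p) (labels p)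
      ≡⟨ ∏-cong (allFin L) (λ {l} _ → sym (count-choices (fits l u) labels P)) ⟩
    ∏[ l ∈ allFin L ] count (compatible l u) Y
      ∎
    where open ≤-Reasoning

  length-Y^L : length Y ^ L ≡ ∏[ p ∈ P ] (L ^ L * val p n ^ j) * V
  length-Y^L = begin
    length Y ^ L                               ≡⟨ cong (_^ L) (length-choices labels P) ⟩
    (∏[ p ∈ P ] length (labels p)) ^ L         ≡⟨ cong (_^ L) (∏-cong P (λ {p} _ → length-labels p)) ⟩
    (∏[ p ∈ P ] (L * val p n)) ^ L             ≡⟨ sym (∏-^ (λ p → L * val p n) L P) ⟩
    ∏[ p ∈ P ] ((L * val p n) ^ L)             ≡⟨ ∏-cong P (λ {p} _ → split (val p n)) ⟩
    ∏[ p ∈ P ] (L ^ L * val p n ^ j * val p n) ≡⟨ ∏-* P ⟩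
    ∏[ p ∈ P ] (L ^ L * val p n ^ j) * V       ∎
    where
    open ≡-Reasoning
    length-labels : ∀ p → length (labels p) ≡ L * val p n
    length-labels p = trans (length-cartesianProductWith _,_ (allFin L) (upTo (val p n)))
                            (cong₂ _*_ (length-allFin L) (length-upTo (val p n)))
    split : ∀ v → (L * v) ^ L ≡ L ^ L * v ^ j * v
    split v = trans (^-distribʳ-* L v L) (trans (cong (L ^ L *_) (*-comm v (v ^ j))) (sym (*-assoc (L ^ L) (v ^ j) v)))

  bound : length W ^ L ≤ k ^ L * ∏[ p ∈ P ] (L ^ L * val p n ^ j)
  bound = *-cancelʳ-≤ _ _ V {{>-nonZero (∏-pos P val[n]≥1)}} (begin
    length W ^ L * V                                ≤⟨ subst (λ N → length W ^ N * V ≤ k ^ N * length Y ^ N) (length-allFin L)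
                                                         (double-counting W (allFin L) Y compatible fibre≤k fibres≥V) ⟩
    k ^ L * length Y ^ L                            ≡⟨ cong (k ^ L *_) length-Y^L ⟩
    k ^ L * (∏[ p ∈ P ] (L ^ L * val p n ^ j) * V)  ≡⟨ sym (*-assoc (k ^ L) _ V) ⟩
    k ^ L * ∏[ p ∈ P ] (L ^ L * val p n ^ j) * V    ∎)
    where open ≤-Reasoning

-- Part (a)

collapse : ∀ {s} → Fin s → Fin s → Fin s → Fin s
collapse a b x = if isYes (x Fin.≟ b) then a else x

module _ {s} {a b : Fin s} where

  collapse-b : collapse a b b ≡ a
  collapse-b with b Fin.≟ b
  ... | yes _   = refl
  ... | no b≢b  = ⊥-elim (b≢b refl)

  collapse-fix : ∀ {x} → x ≢ b → collapse a b x ≡ x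
  collapse-fix {x} x≢b with x Fin.≟ b
  ... | yes x≡b = ⊥-elim (x≢b x≡b)
  ... | no _    = refl

  collapse≡-other : ∀ {x y} → y ≢ a → collapse a b x ≡ y → x ≡ y
  collapse≡-other {x} y≢a eq with x Fin.≟ b
  ... | yes _ = ⊥-elim (y≢a (sym eq))
  ... | no _  = eq

  collapse≡a⇔ : a ≢ b → ∀ {x} → collapse a b x ≡ a ⇔ (x ≡ a ⊎ x ≡ b)
  collapse≡a⇔ a≢b {x} = mk⇔ to from
    where
    to : collapse a b x ≡ a → x ≡ a ⊎ x ≡ b
    to eq with x Fin.≟ b
    ... | yes x≡b = inj₂ x≡b
    ... | no _    = inj₁ eq
    from : x ≡ a ⊎ x ≡ b → collapse a b x ≡ a
    from (inj₁ refl) = collapse-fix a≢b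
    from (inj₂ refl) = collapse-b

  merges : Fin s → Fin s → Bool
  merges σ c = isYes (collapse a b σ Fin.≟ collapse a b c)

  count-merges≥1 : ∀ σ → 1 ≤ count (merges σ) (allFin s)
  count-merges≥1 σ = count-≥1 (∈-allFin σ) (fromWitness refl)

  count-merges≥2 : a ≢ b → ∀ {σ} → σ ≡ a ⊎ σ ≡ b → 2 ≤ count (merges σ) (allFin s)
  count-merges≥2 a≢b σ∈ab = count-≥2 a≢b (∈-allFin a) (∈-allFin b)
    (fromWitness (trans σ↦a (sym (collapse-fix a≢b)))) (fromWitness (trans σ↦a (sym collapse-b)))
    where σ↦a = Equivalence.from (collapse≡a⇔ a≢b) σ∈ab

-- Ordered pairs of distinct symbols, encoded as (a , δ) for (a , punchIn a δ).
Direction : ℕ → Set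
Direction L = Fin (suc L) × Fin L

directions : ∀ L → List (Direction L)
directions L = cartesianProduct (allFin (suc L)) (allFin L)

mergesAlong : ∀ {L} → Direction L → Fin (suc L) → Fin (suc L) → Bool
mergesAlong (a , δ) = merges {a = a} {b = punchIn a δ}

∏-mergesAlong≥ : ∀ L σ → 2 ^ L * 2 ^ L ≤ ∏[ d ∈ directions L ] count (mergesAlong d σ) (allFin (suc L))
∏-mergesAlong≥ L σ = begin
  2 ^ L * 2 ^ L                                           ≤⟨ *-monoˡ-≤ (2 ^ L) h[σ]≥2^L ⟩
  h σ * 2 ^ L                                             ≤⟨ ∏-allFin-≥ L h σ h[a]≥2 ⟩
  ∏[ a ∈ allFin (suc L) ] h a                             ≡⟨ sym (∏-cartesianProductWith _ _,_ (allFin (suc L)) (allFin L)) ⟩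
  ∏[ d ∈ directions L ] count (mergesAlong d σ) (allFin (suc L)) ∎
  where
  open ≤-Reasoning
  h : Fin (suc L) → ℕ
  h a = ∏[ δ ∈ allFin L ] count (mergesAlong (a , δ) σ) (allFin (suc L))
  h[σ]≥2^L : 2 ^ L ≤ h σ
  h[σ]≥2^L = begin
    2 ^ L                  ≡⟨ sym (trans (∏-const (allFin L) 2) (cong (2 ^_) (length-allFin L))) ⟩
    ∏[ δ ∈ allFin L ] 2    ≤⟨ ∏-mono-≤ (allFin L) (λ {δ} _ → count-merges≥2 (Finₚ.punchInᵢ≢i σ δ ∘ sym) (inj₁ refl)) ⟩
    h σ                    ∎
  h[a]≥2 : ∀ a → a ≢ σ → 2 ≤ h a
  h[a]≥2 a a≢σ = ≤-trans (count-merges≥2 (Finₚ.punchInᵢ≢i a δ₀ ∘ sym) (inj₂ (sym (Finₚ.punchIn-punchOut a≢σ))))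
                         (∏-≥-member (λ {δ} _ → count-merges≥1 σ) (∈-allFin δ₀))
    where δ₀ = punchOut a≢σ

module PartA {n j k : ℕ} (1≤n : 1 ≤ n) (1≤k : 1 ≤ k) (sq : Squarefree n) (U : RegularSet n j) {g : Vec ℕ j → ℕ}
             (SR : StronglyKRegular n j k U g) where

  KR : KRegular n j k U g
  KR = StronglyKRegular.kregular SR

  L s : ℕ
  L = suc j
  s = suc L

  W : List (Vec ℕ j)
  W = elems U

  P : List ℕ
  P = primeDivisors n

  X : Vec ℕ j → Fin L → ℕ
  X u = lookup (extend g u)

  symbol : Vec ℕ j → ℕ → Fin s
  symbol u p with Finₚ.any? (λ c → p ∣? X u c)
  ... | yes (c , _) = suc c
  ... | no _        = zero

  symbol≡suc⇔ : ∀ {u} → u ∈ W → ∀ {p} → Prime p → ∀ c → symbol u p ≡ suc c ⇔ p ∣ X u c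
  symbol≡suc⇔ {u} u∈ {p} pp c with Finₚ.any? (λ c → p ∣? X u c)
  ... | yes (c′ , p∣) = mk⇔ (λ { refl → p∣ }) (λ p∣′ → cong suc (extend-prime-unique KR u∈ pp p∣ p∣′))
  ... | no none       = mk⇔ (λ ()) (λ p∣ → ⊥-elim (none (c , p∣)))

  module _ {a b} (a≢b : a ≢ b) {u u′} (u∈ : u ∈ W) (u′∈ : u′ ∈ W)
           (same : ∀ {p} → p ∈ P → collapse a b (symbol u p) ≡ collapse a b (symbol u′ p)) where

    entry-agree : ∀ c → suc c ≢ a → suc c ≢ b → X u c ≡ X u′ c
    entry-agree c ≢a ≢b = ≡-fromPrimeDivisors 1≤n sq (extend-∣ KR u∈ c) (extend-∣ KR u′∈ c) λ p∈ →
      let pp = proj₁ (∈-primeDivisors⁻ n p∈) in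
      ⇔.trans (⇔.sym (symbol≡suc⇔ u∈ pp c))
        (⇔.trans (mk⇔ (transport (same p∈)) (transport (sym (same p∈)))) (symbol≡suc⇔ u′∈ pp c))
      where
      transport : ∀ {σ σ′} → collapse a b σ ≡ collapse a b σ′ → σ ≡ suc c → σ′ ≡ suc c
      transport eq refl = collapse≡-other ≢a (trans (sym eq) (collapse-fix ≢b))

    product-agree : ∀ {c₁ c₂} → a ≡ suc c₁ → b ≡ suc c₂ → X u c₁ * X u c₂ ≡ X u′ c₁ * X u′ c₂
    product-agree {c₁} {c₂} refl refl = ≡-fromPrimeDivisors 1≤n sq (entries-∣ u∈) (entries-∣ u′∈) λ p∈ →
      let pp = proj₁ (∈-primeDivisors⁻ n p∈) in
      ⇔.trans (∣entries⇔ u∈ pp)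
        (⇔.trans (mk⇔ (trans (sym (same p∈))) (trans (same p∈))) (⇔.sym (∣entries⇔ u′∈ pp)))
      where
      c₁≢c₂ : c₁ ≢ c₂
      c₁≢c₂ refl = a≢b refl
      entries-∣ : ∀ {v} → v ∈ W → X v c₁ * X v c₂ ∣ n
      entries-∣ v∈ = coprime-*-∣ (extend-coprime KR v∈ c₁ c₂ c₁≢c₂) (extend-∣ KR v∈ c₁) (extend-∣ KR v∈ c₂)
      ∣entries⇔ : ∀ {v} → v ∈ W → ∀ {p} → Prime p → p ∣ X v c₁ * X v c₂ ⇔ collapse a b (symbol v p) ≡ a
      ∣entries⇔ v∈ pp = ⇔.trans (prime∣*⇔ _ _ pp)
        (⇔.trans (mk⇔ (Sum.map (Equivalence.from (symbol≡suc⇔ v∈ pp c₁)) (Equivalence.from (symbol≡suc⇔ v∈ pp c₂)))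
                       (Sum.map (Equivalence.to (symbol≡suc⇔ v∈ pp c₁)) (Equivalence.to (symbol≡suc⇔ v∈ pp c₂))))
                 (⇔.sym (collapse≡a⇔ a≢b)))

  fibre-atMost : ∀ {a b} → a ≢ b → (Q : Vec ℕ j → Set) →
    (∀ {u u′} → u ∈ W × Q u → u′ ∈ W × Q u′ → ∀ {p} → p ∈ P → collapse a b (symbol u p) ≡ collapse a b (symbol u′ p)) →
    AtMost k (λ u → u ∈ W × Q u)
  fibre-atMost {zero}   {zero}   a≢b = ⊥-elim (a≢b refl)
  fibre-atMost {zero}   {suc c}  a≢b Q same = fibre-atMost₁ Q KR 1≤k c λ Fu Fu′ c′ c′≢c →
    entry-agree a≢b (proj₁ Fu) (proj₁ Fu′) (same Fu Fu′) c′ (λ ()) (c′≢c ∘ Finₚ.suc-injective)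
  fibre-atMost {suc c}  {zero}   a≢b Q same = fibre-atMost₁ Q KR 1≤k c λ Fu Fu′ c′ c′≢c →
    entry-agree a≢b (proj₁ Fu) (proj₁ Fu′) (same Fu Fu′) c′ (c′≢c ∘ Finₚ.suc-injective) (λ ())
  fibre-atMost {suc c₁} {suc c₂} a≢b Q same with Finₚ.<-cmp c₁ c₂
  ... | tri< c₁<c₂ _ _ = fibre-atMost₂ Q SR c₁<c₂ λ Fu Fu′ →
    (λ c c∉ → entry-agree a≢b (proj₁ Fu) (proj₁ Fu′) (same Fu Fu′) c
                (c∉ ∘ inj₁ ∘ Finₚ.suc-injective) (c∉ ∘ inj₂ ∘ Finₚ.suc-injective)) ,
    product-agree a≢b (proj₁ Fu) (proj₁ Fu′) (same Fu Fu′) refl refl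
  ... | tri≈ _ refl _  = ⊥-elim (a≢b refl)
  ... | tri> _ _ c₂<c₁ = fibre-atMost₂ Q SR c₂<c₁ λ {u} {u′} Fu Fu′ →
    (λ c c∉ → entry-agree a≢b (proj₁ Fu) (proj₁ Fu′) (same Fu Fu′) c
                (c∉ ∘ inj₂ ∘ Finₚ.suc-injective) (c∉ ∘ inj₁ ∘ Finₚ.suc-injective)) ,
    trans (*-comm (X u c₂) (X u c₁))
      (trans (product-agree a≢b (proj₁ Fu) (proj₁ Fu′) (same Fu Fu′) refl refl) (*-comm (X u′ c₁) (X u′ c₂)))

  compatible : Direction L → Vec ℕ j → List (Fin s) → Bool
  compatible d u = pointwise (λ p → mergesAlong d (symbol u p)) P

  Y : List (List (Fin s))
  Y = choices (map (λ _ → allFin s) P)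

  fibre≤k : ∀ {d} → d ∈ directions L → ∀ y → count (λ u → compatible d u y) W ≤ k
  fibre≤k {a , δ} _ y = count≤-AtMost (unique U) (fibre-atMost (Finₚ.punchInᵢ≢i a δ ∘ sym) (λ u → T (compatible (a , δ) u y)) same)
    where
    same : ∀ {u u′} → u ∈ W × T (compatible (a , δ) u y) → u′ ∈ W × T (compatible (a , δ) u′ y) →
           ∀ {p} → p ∈ P → collapse a (punchIn a δ) (symbol u p) ≡ collapse a (punchIn a δ) (symbol u′ p)
    same (_ , cu) (_ , cu′) p∈ = let (c , m , m′) = pointwise-common cu cu′ p∈ in trans (toWitness m) (sym (toWitness m′))

  V : ℕ
  V = ∏[ p ∈ P ] (2 ^ L * 2 ^ L)

  fibres≥V : ∀ u → V ≤ ∏[ d ∈ directions L ] count (compatible d u) Y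
  fibres≥V u = begin
    ∏[ p ∈ P ] (2 ^ L * 2 ^ L)
      ≤⟨ ∏-mono-≤ P (λ {p} _ → ∏-mergesAlong≥ L (symbol u p)) ⟩
    ∏[ p ∈ P ] ∏[ d ∈ directions L ] count (mergesAlong d (symbol u p)) (allFin s)
      ≡⟨ ∏-swap _ P (directions L) ⟩
    ∏[ d ∈ directions L ] ∏[ p ∈ P ] count (mergesAlong d (symbol u p)) (allFin s)
      ≡⟨ ∏-cong (directions L) (λ {d} _ → sym (count-choices _ (λ _ → allFin s) P)) ⟩
    ∏[ d ∈ directions L ] count (compatible d u) Y
      ∎
    where open ≤-Reasoning

  bound : length W ^ s * 2 ^ (2 * ω n) ≤ k ^ s * s ^ (s * ω n)
  bound = ^-cancelˡ-≤ L (begin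
    (length W ^ s * 2 ^ (2 * ω n)) ^ L  ≡⟨ left ⟩
    length W ^ (s * L) * V              ≤⟨ subst (λ N → length W ^ N * V ≤ k ^ N * length Y ^ N) length-directions
                                             (double-counting W (directions L) Y compatible fibre≤k (λ {u} _ → fibres≥V u)) ⟩
    k ^ (s * L) * length Y ^ (s * L)    ≡⟨ right ⟩
    (k ^ s * s ^ (s * ω n)) ^ L         ∎)
    where
    open ≤-Reasoning
    length-directions : length (directions L) ≡ s * L
    length-directions = trans (length-cartesianProductWith _,_ (allFin s) (allFin L)) (cong₂ _*_ (length-allFin s) (length-allFin L))
    length-Y : length Y ≡ s ^ ω n
    length-Y = trans (length-choices (λ _ → allFin s) P) (trans (∏-cong P (λ _ → length-allFin s)) (∏-const P s))
    left : (length W ^ s * 2 ^ (2 * ω n)) ^ L ≡ length W ^ (s * L) * V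
    left = begin-equality
      (length W ^ s * 2 ^ (2 * ω n)) ^ L          ≡⟨ ^-distribʳ-* (length W ^ s) (2 ^ (2 * ω n)) L ⟩
      (length W ^ s) ^ L * (2 ^ (2 * ω n)) ^ L    ≡⟨ cong₂ _*_ (^-*-assoc (length W) s L) (^-*-assoc 2 (2 * ω n) L) ⟩
      length W ^ (s * L) * 2 ^ (2 * ω n * L)      ≡⟨ cong (λ e → length W ^ (s * L) * 2 ^ e) (exponents (ω n) L) ⟩
      length W ^ (s * L) * 2 ^ ((L + L) * ω n)    ≡⟨ cong (length W ^ (s * L) *_) (sym (^-*-assoc 2 (L + L) (ω n))) ⟩
      length W ^ (s * L) * (2 ^ (L + L)) ^ ω n    ≡⟨ cong (λ x → length W ^ (s * L) * x ^ ω n) (^-distribˡ-+-* 2 L L) ⟩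
      length W ^ (s * L) * (2 ^ L * 2 ^ L) ^ ω n  ≡⟨ cong (length W ^ (s * L) *_) (sym (∏-const P (2 ^ L * 2 ^ L))) ⟩
      length W ^ (s * L) * V                      ∎
      where
      exponents : ∀ w L → 2 * w * L ≡ (L + L) * w
      exponents = solve-∀
    right : k ^ (s * L) * length Y ^ (s * L) ≡ (k ^ s * s ^ (s * ω n)) ^ L
    right = begin-equality
      k ^ (s * L) * length Y ^ (s * L)         ≡⟨ cong (λ y → k ^ (s * L) * y ^ (s * L)) length-Y ⟩
      k ^ (s * L) * (s ^ ω n) ^ (s * L)        ≡⟨ cong (k ^ (s * L) *_) (^-*-assoc s (ω n) (s * L)) ⟩
      k ^ (s * L) * s ^ (ω n * (s * L))        ≡⟨ cong (λ e → k ^ (s * L) * s ^ e) (exponents s (ω n) L) ⟩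
      k ^ (s * L) * s ^ (s * ω n * L)          ≡⟨ sym (cong₂ _*_ (^-*-assoc k s L) (^-*-assoc s (s * ω n) L)) ⟩
      (k ^ s) ^ L * (s ^ (s * ω n)) ^ L        ≡⟨ sym (^-distribʳ-* (k ^ s) (s ^ (s * ω n)) L) ⟩
      (k ^ s * s ^ (s * ω n)) ^ L              ∎
      where
      exponents : ∀ s w L → w * (s * L) ≡ s * w * L
      exponents = solve-∀

regular-bound : ∀ {n j k : ℕ} → 1 ≤ n → 1 ≤ k → (U : RegularSet n j) {g : Vec ℕ j → ℕ} → KRegular n j k U g →
  length (elems U) ^ (j + 1) ≤ k ^ (j + 1) * ∏[ p ∈ primeDivisors n ] ((j + 1) ^ (j + 1) * val p n ^ j)
regular-bound {j = j} 1≤n 1≤k U KR rewrite +-comm j 1 = PartB.bound 1≤n 1≤k U KR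

strongly-regular-bound : ∀ {n j k : ℕ} → 1 ≤ n → 1 ≤ k → Squarefree n → (U : RegularSet n j) {g : Vec ℕ j → ℕ} →
  StronglyKRegular n j k U g → length (elems U) ^ (j + 2) * 2 ^ (2 * ω n) ≤ k ^ (j + 2) * (j + 2) ^ ((j + 2) * ω n)
strongly-regular-bound {j = j} 1≤n 1≤k sq U SR rewrite +-comm j 2 = PartA.bound 1≤n 1≤k sq U SR

theorem2 : (j k : ℕ) → 1 ≤ j → 1 ≤ k →
    ((n : ℕ) → 1 ≤ n → Squarefree n →
      (U : RegularSet n j) (g : Vec ℕ j → ℕ) → StronglyKRegular n j k U g →
      length (elems U) ^ (j + 2) * 2 ^ (2 * ω n) ≤ k ^ (j + 2) * (j + 2) ^ ((j + 2) * ω n))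
    ×
    ((n : ℕ) → 1 ≤ n →
      (U : RegularSet n j) (g : Vec ℕ j → ℕ) → KRegular n j k U g →
      length (elems U) ^ (j + 1) ≤
        k ^ (j + 1) * product (map (λ p → (j + 1) ^ (j + 1) * val p n ^ j) (primeDivisors n)))
theorem2 j k _ 1≤k =
  (λ n 1≤n sq U g → strongly-regular-bound 1≤n 1≤k sq U) ,
  (λ n 1≤n U g → regular-bound 1≤n 1≤k U)
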